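{- Let $n\in\mathbb N$, $f:\mathbb B^n\to\mathbb B$, and let $X\in\mathcal{IS}_{br}$ compute $f$. Then there exists $Y\in\mathcal{IS}_{br}$ in which the basic instruction $\mathtt{out}.\mathtt{set{:}F}$ does not occur such that $Y$ computes $f$ and $|Y|$ is linear in $|X|$ (bounded by a linear function of $|X|$ whose constants do not depend on $n$, $f$, $X$).
   Context: Let $\mathbb B=\{\mathsf T,\mathsf F\}$. There are Boolean registers named $\mathtt{in}{:}i$ ($i\ge1$), $\mathtt{aux}{:}i$ ($i\ge1$) and $\mathtt{out}$, processing methods $\mathtt{set{:}T}$ (content becomes $\mathsf T$, reply $\mathsf T$), $\mathtt{set{:}F}$ (content becomes $\mathsf F$, reply $\mathsf F$), $\mathtt{get}$ (no change, reply is the content). Basic instructions are $f.m$ ($f$ register name, $m$ method). Primitive instructions: for each basic instruction $a$, the plain instruction $a$, positive test $+a$, negative test $-a$; forward jumps $\#l$ ($l\in\mathbb N$); termination $!$. An instruction sequence is a finite non-empty sequence $X=u_1;\dots;u_k$ of primitive instructions, $|X|=k$. Execution starts at $u_1$: $a$ executes $a$ and proceeds with the next instruction; $+a$ executes $a$ and proceeds with the next instruction if the reply is $\mathsf T$, otherwise skips the next instruction and proceeds with the one after; $-a$ likewise with reply roles reversed; $\#l$ proceeds with the $l$-th next instruction ($\#0$ causes inaction); $!$ terminates; if there is no instruction to proceed with, inaction occurs. $\mathcal{IS}_{br}$ is the set of instruction sequences whose basic instructions are all of the forms $\mathtt{in}{:}i.\mathtt{get}$, $\mathtt{aux}{:}i.\mathtt{get}$,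 $\mathtt{aux}{:}i.\mathtt{set{:}}b$, $\mathtt{out}.\mathtt{set{:}}b$ ($b\in\mathbb B$). $X$ computes $f:\mathbb B^n\to\mathbb B$ if for all $b_1,\dots,b_n$, executing $X$ with $\mathtt{in}{:}i$ initially $b_i$ ($i\le n$) and all auxiliary registers and $\mathtt{out}$ initially $\mathsf F$, execution never executes an instruction on $\mathtt{in}{:}i$ with $i>n$, ends by executing $!$, and leaves $f(b_1,\dots,b_n)$ in $\mathtt{out}$. -}

module Defs where

open import Data.Nat using (ℕ; zero; suc; _<?_; _≡ᵇ_)
open import Data.Bool using (Bool; true; false; if_then_else_)
open import Data.Fin using (fromℕ<)
open import Data.Vec using (Vec; lookup; _[_]≔_)
open import Data.List using (List; []; _∷_; drop; length)
open import Data.List.Relation.Unary.All using (All)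
open import Data.List.Relation.Unary.Any using (Any)
open import Data.Maybe using (Maybe; just; nothing)
open import Data.Product using (Σ; _×_; _,_)
open import Relation.Nullary using (¬_; yes; no)
open import Relation.Binary.PropositionalEquality using (_≡_)

-- Register names.  Indices are shifted by one:
--   inR i  denotes  in:(i+1),   auxR i  denotes  aux:(i+1),   outR  denotes  out.
data Reg : Set where
  inR  : ℕ → Reg
  auxR : ℕ → Reg
  outR : Reg

data Method : Set where
  set : Bool → Method
  get : Method

record BasicInstr : Set where
  constructor _∙_
  field
    reg  : Reg
    meth : Method

data PrimInstr : Set where
  plain : BasicInstr → PrimInstr
  ptest : BasicInstr → PrimInstr
  ntest : BasicInstr → PrimInstr
  jump  : ℕ → PrimInstr
  halt  : PrimInstr

-- Instruction sequences are lists (non-emptiness is required where relevant).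
InstrSeq : Set
InstrSeq = List PrimInstr

NonEmpty : InstrSeq → Set
NonEmpty X = ¬ (X ≡ [])

record State (n : ℕ) : Set where
  field
    inp : Vec Bool n
    aux : ℕ → Bool
    out : Bool
open State public

initial : ∀ {n} → Vec Bool n → State n
initial bs = record { inp = bs ; aux = λ _ → false ; out = false }

-- Executing a basic instruction: nothing signals use of in:i with i > n
-- (a violation); otherwise new state and reply.
apply : ∀ {n} → BasicInstr → State n → Maybe (State n × Bool)
apply {n} (inR i ∙ m) s with i <? n
... | no _ = nothing
... | yes p with m
...   | get   = just (s , lookup (inp s) (fromℕ< p))
...   | set b = just (record s { inp = inp s [ fromℕ< p ]≔ b } , b)
apply (auxR i ∙ get)   s = just (s , aux s i)
apply (auxR i ∙ set b) s =
  just (record s { aux = λ j → if j ≡ᵇ i then b else aux s j } , b)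
apply (outR ∙ get)   s = just (s , out s)
apply (outR ∙ set b) s = just (record s { out = b } , b)

data Outcome (n : ℕ) : Set where
  terminated : State n → Outcome n
  inaction   : Outcome n
  violation  : Outcome n

-- Execution of the remaining suffix (current instruction first), with a step
-- bound (fuel).  Every step moves strictly forward, so |X| steps suffice.
exec : ∀ {n} → ℕ → InstrSeq → State n → Outcome n
exec zero _ _ = inaction
exec (suc k) [] s = inaction
exec (suc k) (halt ∷ _) s = terminated s
exec (suc k) (jump zero ∷ _) s = inaction
exec (suc k) (jump (suc l) ∷ rest) s = exec k (drop l rest) s
exec (suc k) (plain a ∷ rest) s with apply a s
... | nothing = violation
... | just (s′ , _) = exec k rest s′
exec (suc k) (ptest a ∷ rest) s with apply a s
... | nothing = violation
... | just (s′ , true)  = exec k rest s′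
... | just (s′ , false) = exec k (drop 1 rest) s′
exec (suc k) (ntest a ∷ rest) s with apply a s
... | nothing = violation
... | just (s′ , false) = exec k rest s′
... | just (s′ , true)  = exec k (drop 1 rest) s′

run : ∀ {n} → InstrSeq → Vec Bool n → Outcome n
run X bs = exec (length X) X (initial bs)

Computes : (n : ℕ) → (Vec Bool n → Bool) → InstrSeq → Set
Computes n f X = ∀ (bs : Vec Bool n) →
  Σ (State n) λ s → (run X bs ≡ terminated s) × (out s ≡ f bs)

data BrBasic : BasicInstr → Set where
  inGet  : ∀ i → BrBasic (inR i ∙ get)
  auxGet : ∀ i → BrBasic (auxR i ∙ get)
  auxSet : ∀ i b → BrBasic (auxR i ∙ set b)
  outSet : ∀ b → BrBasic (outR ∙ set b)

basicOf : PrimInstr → Maybe BasicInstr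
basicOf (plain a) = just a
basicOf (ptest a) = just a
basicOf (ntest a) = just a
basicOf (jump _)  = nothing
basicOf halt      = nothing

data BrPrim : PrimInstr → Set where
  plainBr : ∀ {a} → BrBasic a → BrPrim (plain a)
  ptestBr : ∀ {a} → BrBasic a → BrPrim (ptest a)
  ntestBr : ∀ {a} → BrBasic a → BrPrim (ntest a)
  jumpBr  : ∀ l → BrPrim (jump l)
  haltBr  : BrPrim halt

ISbr : InstrSeq → Set
ISbr X = NonEmpty X × All BrPrim X

Occurs : BasicInstr → InstrSeq → Set
Occurs a X = Any (λ u → basicOf u ≡ just a) X

-- Let the simulated out live in aux:1 and shift every auxiliary register up by one; the
-- real out then stays F until the very end.  Each instruction becomes a block of three, so
-- jump distances triple, and ! becomes  +aux:1.get ; out.set:T ; !  which copies the simulated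
-- output into out using only set:T.  A step of X is matched by at most three steps of the
-- translation, so the translation halts within 3|X| steps with the same output.
module Submission where

open import Defs
open import Data.Nat using (ℕ; zero; suc; _+_; _*_; _≤_; _<?_; _≡ᵇ_)
open import Data.Nat.Properties using (*-comm; +-identityʳ; ≤-reflexive)
open import Data.Bool using (Bool; true; false; if_then_else_)
open import Data.Vec using (Vec)
open import Data.List using ([]; _∷_; length; drop)
open import Data.List.Relation.Unary.All using (All; []; _∷_; universal)
open import Data.List.Relation.Unary.All.Properties using (All¬⇒¬Any)
open import Data.Unit using (tt)
open import Data.Maybe using (Maybe; just; nothing)
open import Data.Product using (Σ; _×_; _,_)
open import Relation.Nullary using (¬_; yes; no)
open import Relation.Binary.PropositionalEquality
  using (_≡_; _≢_; refl; sym; cong; subst; module ≡-Reasoning)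

relocate : BasicInstr → BasicInstr
relocate (inR i ∙ m)  = inR i ∙ m
relocate (auxR i ∙ m) = auxR (suc i) ∙ m
relocate (outR ∙ m)   = auxR 0 ∙ m

Block : Set
Block = PrimInstr × PrimInstr × PrimInstr

-- After a reply T the jump #2 leaves the block; after F the test skips to #4, which
-- also skips the next block.
block : PrimInstr → Block
block (plain a) = plain (relocate a) , jump 2 , jump 0
block (ptest a) = ptest (relocate a) , jump 2 , jump 4
block (ntest a) = ntest (relocate a) , jump 2 , jump 4
block (jump l)  = jump (l * 3) , jump 0 , jump 0
block halt      = ptest (auxR 0 ∙ get) , plain (outR ∙ set true) , halt

_∷₃_ : Block → InstrSeq → InstrSeq
(u₁ , u₂ , u₃) ∷₃ Y = u₁ ∷ u₂ ∷ u₃ ∷ Y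

translate : InstrSeq → InstrSeq
translate []      = []
translate (u ∷ X) = block u ∷₃ translate X

length-translate : ∀ X → length (translate X) ≡ length X * 3
length-translate []      = refl
length-translate (u ∷ X) = cong (3 +_) (length-translate X)

drop-translate : ∀ l X → drop (l * 3) (translate X) ≡ translate (drop l X)
drop-translate zero    X       = refl
drop-translate (suc l) []      = refl
drop-translate (suc l) (u ∷ X) = drop-translate l X

All₃ : (PrimInstr → Set) → Block → Set
All₃ P (u₁ , u₂ , u₃) = P u₁ × P u₂ × P u₃

All-translate : ∀ {P Q : PrimInstr → Set} → (∀ {u} → P u → All₃ Q (block u)) →
                ∀ {X} → All P X → All Q (translate X)
All-translate blockQ []       = []
All-translate blockQ (p ∷ ps) with blockQ p
... | q₁ , q₂ , q₃ = q₁ ∷ q₂ ∷ q₃ ∷ All-translate blockQ ps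

HaltsWith : ∀ {n} → ℕ → InstrSeq → State n → Bool → Set
HaltsWith {n} k X s b = Σ (State n) λ s₁ → exec k X s ≡ terminated s₁ × out s₁ ≡ b

exec-suc : ∀ {n} k X {s s₁ : State n} →
           exec k X s ≡ terminated s₁ → exec (suc k) X s ≡ terminated s₁
exec-suc (suc k) (halt ∷ X) h = h
exec-suc (suc k) (jump (suc l) ∷ X) h = exec-suc k (drop l X) h
exec-suc (suc k) (plain a ∷ X) {s} h with apply a s
... | just (s′ , _) = exec-suc k X h
exec-suc (suc k) (ptest a ∷ X) {s} h with apply a s
... | just (s′ , true)  = exec-suc k X h
... | just (s′ , false) = exec-suc k (drop 1 X) h
exec-suc (suc k) (ntest a ∷ X) {s} h with apply a s
... | just (s′ , false) = exec-suc k X h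
... | just (s′ , true)  = exec-suc k (drop 1 X) h

halts-suc : ∀ {n} k X {s : State n} {b} → HaltsWith k X s b → HaltsWith (suc k) X s b
halts-suc k X (s₁ , e , o) = s₁ , exec-suc k X e , o

halts-drop-translate : ∀ {n} k l X {t : State n} {b} →
                       HaltsWith k (translate (drop l X)) t b → HaltsWith k (drop (l * 3) (translate X)) t b
halts-drop-translate k l X {t} {b} = subst (λ Y → HaltsWith k Y t b) (sym (drop-translate l X))

data Hides {n : ℕ} (s : State n) : State n → Set where
  hides : ∀ {a} → a 0 ≡ out s → (∀ i → a (suc i) ≡ aux s i) →
          Hides s (record { inp = inp s ; aux = a ; out = false })

data HidesReply {n : ℕ} : Maybe (State n × Bool) → Maybe (State n × Bool) → Set where
  both-fail  : HidesReply nothing nothing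
  both-reply : ∀ {s t b c} → Hides s t → b ≡ c → HidesReply (just (s , b)) (just (t , c))

apply-relocate : ∀ {n} a {s t : State n} → Hides s t → HidesReply (apply a s) (apply (relocate a) t)
apply-relocate {n} (inR i ∙ m) r with i <? n
... | no _ = both-fail
apply-relocate (inR i ∙ get)   (hides out≡ aux≡) | yes _ = both-reply (hides out≡ aux≡) refl
apply-relocate (inR i ∙ set b) (hides out≡ aux≡) | yes _ = both-reply (hides out≡ aux≡) refl
apply-relocate (auxR i ∙ get)   (hides out≡ aux≡) = both-reply (hides out≡ aux≡) (sym (aux≡ i))
apply-relocate (auxR i ∙ set b) (hides out≡ aux≡) =
  both-reply (hides out≡ (λ j → cong (λ x → if j ≡ᵇ i then b else x) (aux≡ j))) refl
apply-relocate (outR ∙ get)   (hides out≡ aux≡) = both-reply (hides out≡ aux≡) (sym out≡)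
apply-relocate (outR ∙ set b) (hides out≡ aux≡) = both-reply (hides refl aux≡) refl

halt-block-copies : ∀ {n} k Y (v : Vec Bool n) a →
  exec (3 + k) (block halt ∷₃ Y) (record { inp = v ; aux = a ; out = false })
    ≡ terminated (record { inp = v ; aux = a ; out = a 0 })
halt-block-copies k Y v a with a 0
... | true  = refl
... | false = refl

-- The missing clauses (no fuel, end of X, #0, a violation) contradict the hypothesis.
simulate : ∀ {n} k X {s t : State n} {b} → Hides s t →
           HaltsWith k X s b → HaltsWith (k * 3) (translate X) t b
simulate (suc k) (halt ∷ X) {s} (hides {a} out≡ _) (_ , refl , refl) =
  _ , halt-block-copies (k * 3) (translate X) (inp s) a , out≡
simulate (suc k) (jump (suc l) ∷ X) r h =
  halts-suc (suc (k * 3)) (drop (l * 3) (translate X))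
    (halts-suc (k * 3) (drop (l * 3) (translate X))
      (halts-drop-translate (k * 3) l X (simulate k (drop l X) r h)))
simulate (suc k) (plain a ∷ X) {s} {t} r h with apply a s | apply (relocate a) t | apply-relocate a r
... | just _ | just _ | both-reply r′ refl = halts-suc (k * 3) (translate X) (simulate k X r′ h)
simulate (suc k) (ptest a ∷ X) {s} {t} r h with apply a s | apply (relocate a) t | apply-relocate a r
... | just (_ , true)  | just _ | both-reply r′ refl = halts-suc (k * 3) (translate X) (simulate k X r′ h)
... | just (_ , false) | just _ | both-reply r′ refl =
  halts-suc (k * 3) (drop 3 (translate X))
    (halts-drop-translate (k * 3) 1 X (simulate k (drop 1 X) r′ h))
simulate (suc k) (ntest a ∷ X) {s} {t} r h with apply a s | apply (relocate a) t | apply-relocate a r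
... | just (_ , false) | just _ | both-reply r′ refl = halts-suc (k * 3) (translate X) (simulate k X r′ h)
... | just (_ , true)  | just _ | both-reply r′ refl =
  halts-suc (k * 3) (drop 3 (translate X))
    (halts-drop-translate (k * 3) 1 X (simulate k (drop 1 X) r′ h))

translate-computes : ∀ n f X → Computes n f X → Computes n f (translate X)
translate-computes n f X computes bs =
  subst (λ k → HaltsWith k (translate X) (initial bs) (f bs)) (sym (length-translate X))
        (simulate (length X) X (hides refl (λ _ → refl)) (computes bs))

relocate-br : ∀ {a} → BrBasic a → BrBasic (relocate a)
relocate-br (inGet i)    = inGet i
relocate-br (auxGet i)   = auxGet (suc i)
relocate-br (auxSet i b) = auxSet (suc i) b
relocate-br (outSet b)   = auxSet 0 b

block-br : ∀ {u} → BrPrim u → All₃ BrPrim (block u)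
block-br (plainBr a) = plainBr (relocate-br a) , jumpBr 2 , jumpBr 0
block-br (ptestBr a) = ptestBr (relocate-br a) , jumpBr 2 , jumpBr 4
block-br (ntestBr a) = ntestBr (relocate-br a) , jumpBr 2 , jumpBr 4
block-br (jumpBr l)  = jumpBr (l * 3) , jumpBr 0 , jumpBr 0
block-br haltBr      = ptestBr (auxGet 0) , plainBr (outSet true) , haltBr

translate-br : ∀ {X} → ISbr X → ISbr (translate X)
translate-br {[]}    (nonempty , _) = nonempty , []
translate-br {_ ∷ _} (_ , br)       = (λ ()) , All-translate block-br br

Avoids : BasicInstr → PrimInstr → Set
Avoids a u = basicOf u ≢ just a

relocate-avoids-out : ∀ {m} a → Avoids (outR ∙ m) (plain (relocate a))
relocate-avoids-out (inR i ∙ _)  ()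
relocate-avoids-out (auxR i ∙ _) ()
relocate-avoids-out (outR ∙ _)   ()

block-avoids-out-set-false : ∀ u → All₃ (Avoids (outR ∙ set false)) (block u)
block-avoids-out-set-false (plain a) = relocate-avoids-out a , (λ ()) , (λ ())
block-avoids-out-set-false (ptest a) = relocate-avoids-out a , (λ ()) , (λ ())
block-avoids-out-set-false (ntest a) = relocate-avoids-out a , (λ ()) , (λ ())
block-avoids-out-set-false (jump l)  = (λ ()) , (λ ()) , (λ ())
block-avoids-out-set-false halt      = (λ ()) , (λ ()) , (λ ())

translate-avoids-out-set-false : ∀ X → ¬ Occurs (outR ∙ set false) (translate X)
translate-avoids-out-set-false X =
  All¬⇒¬Any (All-translate (λ {u} _ → block-avoids-out-set-false u) (universal (λ _ → tt) X))

theorem2 : Σ ℕ λ c → Σ ℕ λ d →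
    (n : ℕ) (f : Vec Bool n → Bool) (X : InstrSeq) →
    ISbr X → Computes n f X →
    Σ InstrSeq λ Y → ISbr Y × ¬ Occurs (outR ∙ set false) Y ×
      Computes n f Y × length Y ≤ c * length X + d
theorem2 = 3 , 0 , λ n f X br computes →
  translate X , translate-br br , translate-avoids-out-set-false X ,
  translate-computes n f X computes , ≤-reflexive (length-bound X)
  where
  open ≡-Reasoning
  length-bound : ∀ X → length (translate X) ≡ 3 * length X + 0
  length-bound X = begin
    length (translate X) ≡⟨ length-translate X ⟩
    length X * 3         ≡⟨ *-comm (length X) 3 ⟩
    3 * length X         ≡⟨ +-identityʳ (3 * length X) ⟨
    3 * length X + 0     ∎
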